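{- Let $n\ge 1$ and ${\varepsilon}\in\{1,-1\}$. Then $$\sum_{\pi\in S_n} {\varepsilon}^{{\rm inv}(\pi)}\, q^{{\rm maj}(\pi)}\, z^{{\rm last}(\pi)} = \left(\prod_{i=1}^{n-1} [i]_{{\varepsilon}^{i-1} q}\right)\cdot [n]_{{\varepsilon}^{n-1} q/z}\cdot z^{n-1},$$ i.e. it equals $[1]_q[2]_{{\varepsilon} q}[3]_q[4]_{{\varepsilon} q}\cdots[n-1]_{{\varepsilon}^{n-2}q}\cdot [n]_{{\varepsilon}^{n-1}q/z}\, z^{n-1}$.
   Context: $S_n$ is the symmetric group on $\{1,\dots,n\}$, permutations written in one-line notation. ${\rm inv}(\pi)$ is the number of inversions of $\pi$ (equivalently its Coxeter length with respect to the adjacent transpositions); ${\rm maj}(\pi)=\sum\{\,i: \pi(i)>\pi(i+1)\,\}$ is the major index; ${\rm last}(\pi):=\pi(n)-1$. For a positive integer $k$ and an indeterminate expression $t$, $[k]_t := (1-t^k)/(1-t) = 1+t+\cdots+t^{k-1}$. -}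

module Defs where

open import Level using (Level)
open import Data.Bool using (Bool; true; false; _∧_; not; if_then_else_)
open import Data.Nat using (ℕ; zero; suc; _∸_; _<ᵇ_; _≡ᵇ_) renaming (_+_ to _+ℕ_)
open import Data.Bool.ListAction using (any)
open import Data.Nat.ListAction using (sum)
open import Data.List using (List; []; _∷_; map; concatMap; filterᵇ; upTo)
open import Algebra.Bundles using (CommutativeRing)

-- Permutations of {1,…,n} in one-line notation, as lists of naturals.

words : ℕ → ℕ → List (List ℕ)
words n zero    = [] ∷ []
words n (suc k) = concatMap (λ a → map (a ∷_) (words n k)) (map suc (upTo n))

distinct : List ℕ → Bool
distinct []       = true
distinct (x ∷ xs) = not (any (x ≡ᵇ_) xs) ∧ distinct xs

Sn : ℕ → List (List ℕ)
Sn n = filterᵇ distinct (words n n)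

inv : List ℕ → ℕ
inv []       = 0
inv (x ∷ xs) = sum (map (λ y → if y <ᵇ x then 1 else 0) xs) +ℕ inv xs

-- maj(π) = Σ { i : π(i) > π(i+1) }, positions counted from 1
majFrom : ℕ → List ℕ → ℕ
majFrom i []           = 0
majFrom i (x ∷ [])     = 0
majFrom i (x ∷ y ∷ r)  = (if y <ᵇ x then i else 0) +ℕ majFrom (suc i) (y ∷ r)

maj : List ℕ → ℕ
maj = majFrom 1

lastElem : List ℕ → ℕ
lastElem []          = 0
lastElem (x ∷ [])    = x
lastElem (x ∷ y ∷ r) = lastElem (y ∷ r)

lastStat : List ℕ → ℕ
lastStat π = lastElem π ∸ 1

module RingOps {c ℓ : Level} (R : CommutativeRing c ℓ) where
  open CommutativeRing R

  pow : Carrier → ℕ → Carrier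
  pow x zero    = 1#
  pow x (suc k) = x * pow x k

  sumR : List Carrier → Carrier
  sumR []       = 0#
  sumR (x ∷ xs) = x + sumR xs

  prodR : List Carrier → Carrier
  prodR []       = 1#
  prodR (x ∷ xs) = x * prodR xs

  qint : ℕ → Carrier → Carrier
  qint k t = sumR (map (pow t) (upTo k))

  lhs : ℕ → Carrier → Carrier → Carrier → Carrier
  lhs n ε q z = sumR (map (λ π → pow ε (inv π) * pow q (maj π) * pow z (lastStat π)) (Sn n))

  prodPart : ℕ → Carrier → Carrier → Carrier
  prodPart n ε q = prodR (map (λ j → qint (suc j) (pow ε j * q)) (upTo (n ∸ 1)))

module Submission where

-- Deleting the last letter a = b+1 of π ∈ S_(n+1) and standardising the remaining word gives
-- σ ∈ S_n with π = extend σ a, and every (σ, b) with b ≤ n arises exactly once.  Under this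
-- bijection inv grows by the n − b letters of σ that are ≥ a, and maj grows by n exactly when
-- the last letter of σ is ≥ a.  So the generating functions E(n, b) of the permutations of
-- length n+1 ending in b+1 obey E(n+1, b) = ε^(n+1−b) Σ_b′ q^([b′ ≥ b]·(n+1)) E(n, b′).  With
-- t = ε^n q, the inner sum splits into geometric sums t^m [b]_t + q^(n+1) [m]_t (m = n+1−b), and
-- ε² = 1 turns ε^m t^m and ε^m q^(n+1) into T^m and t^b T^m for T = ε^(n+1) q; hence
-- E(n, b) = Π_(i≤n) [i]_(ε^(i−1) q) · (ε^n q)^(n−b).  Finally Σ_b E(n, b) z^b is a homogenised
-- geometric sum in ε^n q and z.

open import Defs
open import Level using (Level)
open import Data.Nat using (ℕ; suc; _≤_; _∸_)
open import Data.Sum using (_⊎_; inj₁; inj₂)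
open import Algebra.Bundles using (CommutativeRing)

module PermutationStatistics where

  open import Function using (_∘_)
  open import Data.Bool using (Bool; true; false; _∧_; not; if_then_else_; T)
  open import Data.Bool.ListAction using (any; or)
  open import Data.Bool.Properties using (∧-zeroʳ; ∧-identityʳ; T-∧)
  open import Data.Nat
  open import Data.Nat.Properties
  open import Data.Nat.ListAction using (sum)
  open import Data.List using (List; []; _∷_; _∷ʳ_; map; length)
  open import Data.List.Properties using (map-∘; map-cong; length-map)
  open import Data.List.Relation.Unary.All as All using (All; []; _∷_)
  open import Data.Product using (_×_; _,_; proj₁; proj₂)
  open import Relation.Nullary using (yes; no; ¬_; contradiction)
  open import Function.Bundles using (Equivalence)
  open import Relation.Binary.PropositionalEquality
  open import Algebra.Properties.CommutativeSemigroup +-commutativeSemigroup using (interchange)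

  ≡ᵇ-sym : ∀ x y → (x ≡ᵇ y) ≡ (y ≡ᵇ x)
  ≡ᵇ-sym zero    zero    = refl
  ≡ᵇ-sym zero    (suc y) = refl
  ≡ᵇ-sym (suc x) zero    = refl
  ≡ᵇ-sym (suc x) (suc y) = ≡ᵇ-sym x y

  T-not⇒¬T : ∀ {b} → T (not b) → ¬ T b
  T-not⇒¬T {true}  ()
  T-not⇒¬T {false} _ ()

  count : (ℕ → Bool) → List ℕ → ℕ
  count p xs = sum (map (λ y → if p y then 1 else 0) xs)

  count-cong : ∀ {p q} → (∀ y → p y ≡ q y) → ∀ xs → count p xs ≡ count q xs
  count-cong p≗q xs = cong sum (map-cong (λ y → cong (λ b → if b then 1 else 0) (p≗q y)) xs)

  count-map : ∀ p f xs → count p (map f xs) ≡ count (p ∘ f) xs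
  count-map p f xs = cong sum (sym (map-∘ xs))

  count-∷ʳ : ∀ p xs a → count p (xs ∷ʳ a) ≡ count p xs + (if p a then 1 else 0)
  count-∷ʳ p []       a = +-identityʳ _
  count-∷ʳ p (x ∷ xs) a =
    trans (cong (px +_) (count-∷ʳ p xs a)) (sym (+-assoc px (count p xs) _))
    where px = if p x then 1 else 0

  count-complement : ∀ p xs → count p xs + count (not ∘ p) xs ≡ length xs
  count-complement p []       = refl
  count-complement p (x ∷ xs) with p x
  ... | true  = cong suc (count-complement p xs)
  ... | false = trans (+-suc _ _) (cong suc (count-complement p xs))

  shift≥ : ℕ → ℕ → ℕ
  shift≥ zero    y       = suc y
  shift≥ (suc a) zero    = zero
  shift≥ (suc a) (suc y) = suc (shift≥ a y)

  extend : List ℕ → ℕ → List ℕ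
  extend σ a = map (shift≥ a) σ ∷ʳ a

  shift≥-<ᵇ : ∀ a x y → (shift≥ a x <ᵇ shift≥ a y) ≡ (x <ᵇ y)
  shift≥-<ᵇ zero    x       y       = refl
  shift≥-<ᵇ (suc a) zero    zero    = refl
  shift≥-<ᵇ (suc a) zero    (suc y) = refl
  shift≥-<ᵇ (suc a) (suc x) zero    = refl
  shift≥-<ᵇ (suc a) (suc x) (suc y) = shift≥-<ᵇ a x y

  shift≥-≡ᵇ : ∀ a x y → (shift≥ a x ≡ᵇ shift≥ a y) ≡ (x ≡ᵇ y)
  shift≥-≡ᵇ zero    x       y       = refl
  shift≥-≡ᵇ (suc a) zero    zero    = refl
  shift≥-≡ᵇ (suc a) zero    (suc y) = refl
  shift≥-≡ᵇ (suc a) (suc x) zero    = refl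
  shift≥-≡ᵇ (suc a) (suc x) (suc y) = shift≥-≡ᵇ a x y

  <ᵇ-shift≥ : ∀ a y → (a <ᵇ shift≥ a y) ≡ not (y <ᵇ a)
  <ᵇ-shift≥ zero    y       = refl
  <ᵇ-shift≥ (suc a) zero    = refl
  <ᵇ-shift≥ (suc a) (suc y) = <ᵇ-shift≥ a y

  inv-∷ʳ : ∀ xs a → inv (xs ∷ʳ a) ≡ inv xs + count (a <ᵇ_) xs
  inv-∷ʳ []       a = refl
  inv-∷ʳ (x ∷ xs) a = begin
    count (_<ᵇ x) (xs ∷ʳ a) + inv (xs ∷ʳ a)
      ≡⟨ cong₂ _+_ (count-∷ʳ (_<ᵇ x) xs a) (inv-∷ʳ xs a) ⟩
    (count (_<ᵇ x) xs + (if a <ᵇ x then 1 else 0)) + (inv xs + count (a <ᵇ_) xs)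
      ≡⟨ interchange (count (_<ᵇ x) xs) _ (inv xs) _ ⟩
    inv (x ∷ xs) + count (a <ᵇ_) (x ∷ xs) ∎
    where open ≡-Reasoning

  inv-map-shift≥ : ∀ a xs → inv (map (shift≥ a) xs) ≡ inv xs
  inv-map-shift≥ a []       = refl
  inv-map-shift≥ a (x ∷ xs) = cong₂ _+_
    (trans (count-map (_<ᵇ shift≥ a x) (shift≥ a) xs) (count-cong (λ y → shift≥-<ᵇ a y x) xs))
    (inv-map-shift≥ a xs)

  inv-extend : ∀ σ a → inv (extend σ a) ≡ inv σ + count (λ y → not (y <ᵇ a)) σ
  inv-extend σ a = begin
    inv (map (shift≥ a) σ ∷ʳ a)                    ≡⟨ inv-∷ʳ (map (shift≥ a) σ) a ⟩
    inv (map (shift≥ a) σ) + count (a <ᵇ_) (map (shift≥ a) σ)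
      ≡⟨ cong₂ _+_ (inv-map-shift≥ a σ) (trans (count-map (a <ᵇ_) (shift≥ a) σ) (count-cong (<ᵇ-shift≥ a) σ)) ⟩
    inv σ + count (λ y → not (y <ᵇ a)) σ           ∎
    where open ≡-Reasoning

  majFrom-map-shift≥ : ∀ a i xs → majFrom i (map (shift≥ a) xs) ≡ majFrom i xs
  majFrom-map-shift≥ a i []          = refl
  majFrom-map-shift≥ a i (x ∷ [])    = refl
  majFrom-map-shift≥ a i (x ∷ y ∷ r) = cong₂ _+_
    (cong (λ b → if b then i else 0) (shift≥-<ᵇ a y x))
    (majFrom-map-shift≥ a (suc i) (y ∷ r))

  majFrom-∷ʳ : ∀ i x xs b → majFrom i (x ∷ xs ∷ʳ b) ≡
    majFrom i (x ∷ xs) + (if b <ᵇ lastElem (x ∷ xs) then i + length xs else 0)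
  majFrom-∷ʳ i x [] b with b <ᵇ x
  ... | true  = refl
  ... | false = refl
  majFrom-∷ʳ i x (y ∷ ys) b = begin
    first + majFrom (suc i) (y ∷ ys ∷ʳ b)
      ≡⟨ cong (first +_) (majFrom-∷ʳ (suc i) y ys b) ⟩
    first + (majFrom (suc i) (y ∷ ys) + descent (suc i + length ys))
      ≡⟨ sym (+-assoc first _ _) ⟩
    majFrom i (x ∷ y ∷ ys) + descent (suc i + length ys)
      ≡⟨ cong (λ p → majFrom i (x ∷ y ∷ ys) + descent p) (sym (+-suc i (length ys))) ⟩
    majFrom i (x ∷ y ∷ ys) + descent (i + suc (length ys))
      ∎
    where
    open ≡-Reasoning
    first = if y <ᵇ x then i else 0
    descent : ℕ → ℕ
    descent p = if b <ᵇ lastElem (y ∷ ys) then p else 0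

  lastElem-∷ʳ : ∀ xs b → lastElem (xs ∷ʳ b) ≡ b
  lastElem-∷ʳ []          b = refl
  lastElem-∷ʳ (x ∷ [])    b = refl
  lastElem-∷ʳ (x ∷ y ∷ r) b = lastElem-∷ʳ (y ∷ r) b

  lastElem-extend : ∀ σ a → lastElem (extend σ a) ≡ a
  lastElem-extend σ a = lastElem-∷ʳ (map (shift≥ a) σ) a

  lastStat-extend : ∀ σ b → lastStat (extend σ (suc b)) ≡ b
  lastStat-extend σ b = cong (_∸ 1) (lastElem-extend σ (suc b))

  lastElem-map : ∀ f x xs → lastElem (map f (x ∷ xs)) ≡ f (lastElem (x ∷ xs))
  lastElem-map f x []      = refl
  lastElem-map f x (y ∷ r) = lastElem-map f y r

  maj-extend : ∀ x xs a → maj (extend (x ∷ xs) a) ≡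
    maj (x ∷ xs) + (if lastElem (x ∷ xs) <ᵇ a then 0 else length (x ∷ xs))
  maj-extend x xs a = begin
    majFrom 1 (shifted ∷ʳ a)
      ≡⟨ majFrom-∷ʳ 1 (shift≥ a x) (map (shift≥ a) xs) a ⟩
    maj shifted + (if a <ᵇ lastElem shifted then suc (length (map (shift≥ a) xs)) else 0)
      ≡⟨ cong₂ _+_ (majFrom-map-shift≥ a 1 (x ∷ xs)) descent ⟩
    maj (x ∷ xs) + (if lastElem (x ∷ xs) <ᵇ a then 0 else length (x ∷ xs))
      ∎
    where
    open ≡-Reasoning
    shifted = map (shift≥ a) (x ∷ xs)
    descent : (if a <ᵇ lastElem shifted then suc (length (map (shift≥ a) xs)) else 0)
            ≡ (if lastElem (x ∷ xs) <ᵇ a then 0 else length (x ∷ xs))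
    descent rewrite lastElem-map (shift≥ a) x xs | <ᵇ-shift≥ a (lastElem (x ∷ xs)) | length-map (shift≥ a) xs
      with lastElem (x ∷ xs) <ᵇ a
    ... | true  = refl
    ... | false = refl

  not-any-∷ʳ : ∀ x w b → not (any (x ≡ᵇ_) (w ∷ʳ b)) ≡ not (any (x ≡ᵇ_) w) ∧ not (x ≡ᵇ b)
  not-any-∷ʳ x []      b with x ≡ᵇ b
  ... | true  = refl
  ... | false = refl
  not-any-∷ʳ x (y ∷ w) b with x ≡ᵇ y
  ... | true  = refl
  ... | false = not-any-∷ʳ x w b

  distinct-∷ʳ : ∀ w b → distinct (w ∷ʳ b) ≡ not (any (b ≡ᵇ_) w) ∧ distinct w
  distinct-∷ʳ []      b = refl
  distinct-∷ʳ (x ∷ w) b rewrite not-any-∷ʳ x w b | distinct-∷ʳ w b | ≡ᵇ-sym x b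
    with b ≡ᵇ x | not (any (x ≡ᵇ_) w)
  ... | true  | true  = refl
  ... | true  | false = refl
  ... | false | true  = refl
  ... | false | false = sym (∧-zeroʳ _)

  distinct-map-shift≥ : ∀ a w → distinct (map (shift≥ a) w) ≡ distinct w
  distinct-map-shift≥ a []      = refl
  distinct-map-shift≥ a (x ∷ w) = cong₂ (λ b c → not b ∧ c) any-shift≥ (distinct-map-shift≥ a w)
    where
    any-shift≥ : any (shift≥ a x ≡ᵇ_) (map (shift≥ a) w) ≡ any (x ≡ᵇ_) w
    any-shift≥ = cong or (trans (sym (map-∘ w)) (map-cong (shift≥-≡ᵇ a x) w))

  count-none : ∀ p xs {k} → All (λ y → ¬ T (p y)) xs → count p xs ≤ k
  count-none p []       []         = z≤n
  count-none p (x ∷ xs) (¬px ∷ ps) with p x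
  ... | true  = contradiction _ ¬px
  ... | false = count-none p xs ps

  count-avoiding-fresh : ∀ p h xs → T (not (any (h ≡ᵇ_) xs)) →
    count (λ y → p y ∧ not (y ≡ᵇ h)) xs ≡ count p xs
  count-avoiding-fresh p h []       _ = refl
  count-avoiding-fresh p h (y ∷ xs) fresh with h ≡ᵇ y in h≡ᵇy
  ... | false rewrite ≡ᵇ-sym y h | h≡ᵇy | ∧-identityʳ (p y) =
    cong (_ +_) (count-avoiding-fresh p h xs fresh)

  count-≤-suc-avoiding : ∀ p h xs → T (distinct xs) →
    count p xs ≤ suc (count (λ y → p y ∧ not (y ≡ᵇ h)) xs)
  count-≤-suc-avoiding p h []       _ = z≤n
  count-≤-suc-avoiding p h (x ∷ xs) d with T-∧ .Equivalence.to d | x ≡ᵇ h in x≡ᵇh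
  ... | fresh , _ | true rewrite ∧-zeroʳ (p x)
                               | ≡ᵇ⇒≡ x h (subst T (sym x≡ᵇh) _)
                               | count-avoiding-fresh p h xs fresh
    = +-monoˡ-≤ (count p xs) (indicator≤1 (p h))
    where
    indicator≤1 : ∀ b → (if b then 1 else 0) ≤ 1
    indicator≤1 true  = ≤-refl
    indicator≤1 false = z≤n
  ... | _ , dxs | false rewrite ∧-identityʳ (p x) | sym (+-suc (if p x then 1 else 0) (count (λ y → p y ∧ not (y ≡ᵇ h)) xs))
    = +-monoʳ-≤ (if p x then 1 else 0) (count-≤-suc-avoiding p h xs dxs)

  count-≤-width : ∀ p lo hi xs → T (distinct xs) →
    All (λ y → T (p y) → lo ≤ y × y < hi) xs → count p xs ≤ hi ∸ lo
  count-≤-width p lo zero    xs _ inside =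
    count-none p xs (All.map (λ f py → n≮0 (proj₂ (f py))) inside)
  count-≤-width p lo (suc h) xs d inside with lo ≤? h
  ... | no lo≰h =
    count-none p xs (All.map (λ f py → lo≰h (≤-trans (proj₁ (f py)) (≤-pred (proj₂ (f py))))) inside)
  ... | yes lo≤h = begin
    count p xs                                    ≤⟨ count-≤-suc-avoiding p h xs d ⟩
    suc (count (λ y → p y ∧ not (y ≡ᵇ h)) xs)      ≤⟨ s≤s (count-≤-width _ lo h xs d (All.map below-h inside)) ⟩
    suc (h ∸ lo)                                  ≡⟨ sym (+-∸-assoc 1 lo≤h) ⟩
    suc h ∸ lo                                    ∎
    where
    open ≤-Reasoning
    below-h : ∀ {y} → (T (p y) → lo ≤ y × y < suc h) → T (p y ∧ not (y ≡ᵇ h)) → lo ≤ y × y < h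
    below-h {y} f py∧y≢h with T-∧ .Equivalence.to py∧y≢h
    ... | py , y≢h with f py
    ... | lo≤y , y<sh = lo≤y , ≤∧≢⇒< (≤-pred y<sh) (T-not⇒¬T y≢h ∘ ≡⇒≡ᵇ y h)

  record IsPermutation (n : ℕ) (σ : List ℕ) : Set where
    field
      letters-distinct : T (distinct σ)
      length≡          : length σ ≡ n
      letters-bounded  : All (λ y → 1 ≤ y × y ≤ n) σ

  count-≥-permutation : ∀ {n σ b} → IsPermutation n σ → b ≤ n →
    count (λ y → not (y <ᵇ suc b)) σ ≡ n ∸ b
  count-≥-permutation {n} {σ} {b} perm b≤n = ≤-antisym above below
    where
    open IsPermutation perm
    above : count (λ y → not (y <ᵇ suc b)) σ ≤ n ∸ b
    above = count-≤-width _ (suc b) (suc n) σ letters-distinct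
      (All.map (λ { (_ , y≤n) y≮sb → ≮⇒≥ (T-not⇒¬T y≮sb ∘ <⇒<ᵇ) , s≤s y≤n })
               letters-bounded)
    smaller : count (_<ᵇ suc b) σ ≤ b
    smaller = count-≤-width _ 1 (suc b) σ letters-distinct
      (All.map (λ { {y} (1≤y , _) y<sb → 1≤y , <ᵇ⇒< y (suc b) y<sb }) letters-bounded)
    complement : n ∸ count (_<ᵇ suc b) σ ≡ count (λ y → not (y <ᵇ suc b)) σ
    complement = trans (cong (_∸ count (_<ᵇ suc b) σ) (trans (sym length≡) (sym (count-complement _ σ))))
                       (m+n∸m≡n (count (_<ᵇ suc b) σ) _)
    below : n ∸ b ≤ count (λ y → not (y <ᵇ suc b)) σ
    below = subst (n ∸ b ≤_) complement (∸-monoʳ-≤ n smaller)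

open PermutationStatistics

module FiniteSums {c ℓ : Level} (R : CommutativeRing c ℓ) where

  open import Function using (_∘_)
  open import Data.Bool using (Bool; true; false; if_then_else_)
  open import Data.Nat as ℕ using (zero; _<_; _≡ᵇ_; _<ᵇ_; s≤s)
  import Data.Nat.Properties as ℕ
  open import Data.Bool.Properties using (T-≡)
  open import Function.Bundles using (Equivalence)
  open import Data.List using (List; []; _∷_; _∷ʳ_; _++_; map; concatMap; filterᵇ; upTo; applyUpTo)
  open import Data.List.Properties using (map-∘)
  open import Relation.Binary.PropositionalEquality as ≡ using (_≡_)
  open CommutativeRing R hiding (zero)
  open RingOps R
  open import Relation.Binary.Reasoning.Setoid setoid
  open import Algebra.Properties.Semiring.Sum semiring
    using (sum; sum-cong-≋; sum-replicate-zero; ∑-distrib-+; *-distribˡ-sum; *-distribʳ-sum; ∑-permute)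
  open import Algebra.Properties.Semiring.Exp semiring using (_^_; ^-homo-*; ^-assocʳ)
  open import Algebra.Properties.CommutativeSemiring.Exp commutativeSemiring using (^-distrib-*)
  open import Data.Fin using (toℕ)
  open import Data.Fin.Properties using (toℕ<n; opposite-prop)
  open import Data.Fin.Permutation using (reverse)

  ∑ : {A : Set} → List A → (A → Carrier) → Carrier
  ∑ xs f = sumR (map f xs)

  ∑-cong : ∀ {A : Set} (xs : List A) {f g : A → Carrier} → (∀ x → f x ≈ g x) → ∑ xs f ≈ ∑ xs g
  ∑-cong []       f≈g = refl
  ∑-cong (x ∷ xs) f≈g = +-cong (f≈g x) (∑-cong xs f≈g)

  ∑-++ : ∀ {A : Set} (xs ys : List A) (f : A → Carrier) → ∑ (xs ++ ys) f ≈ ∑ xs f + ∑ ys f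
  ∑-++ []       ys f = sym (+-identityˡ _)
  ∑-++ (x ∷ xs) ys f = trans (+-congˡ (∑-++ xs ys f)) (sym (+-assoc _ _ _))

  ∑-map : ∀ {A B : Set} (g : A → B) xs (f : B → Carrier) → ∑ (map g xs) f ≡ ∑ xs (f ∘ g)
  ∑-map g xs f = ≡.cong sumR (≡.sym (map-∘ xs))

  ∑-concatMap : ∀ {A B : Set} (g : A → List B) xs (f : B → Carrier) → ∑ (concatMap g xs) f ≈ ∑ xs (λ x → ∑ (g x) f)
  ∑-concatMap g []       f = refl
  ∑-concatMap g (x ∷ xs) f = trans (∑-++ (g x) (concatMap g xs) f) (+-congˡ (∑-concatMap g xs f))

  ∑-filterᵇ : ∀ {A : Set} (p : A → Bool) xs (f : A → Carrier) →
    ∑ (filterᵇ p xs) f ≈ ∑ xs (λ x → if p x then f x else 0#)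
  ∑-filterᵇ p []       f = refl
  ∑-filterᵇ p (x ∷ xs) f with p x
  ... | true  = +-congˡ (∑-filterᵇ p xs f)
  ... | false = trans (∑-filterᵇ p xs f) (sym (+-identityˡ _))

  ∑-zero : ∀ {A : Set} (xs : List A) → ∑ xs (λ _ → 0#) ≈ 0#
  ∑-zero []       = refl
  ∑-zero (x ∷ xs) = trans (+-identityˡ _) (∑-zero xs)

  ∑-*ˡ : ∀ {A : Set} y (xs : List A) (f : A → Carrier) → y * ∑ xs f ≈ ∑ xs (λ x → y * f x)
  ∑-*ˡ y []       f = zeroʳ y
  ∑-*ˡ y (x ∷ xs) f = trans (distribˡ y _ _) (+-congˡ (∑-*ˡ y xs f))

  ∑-*ʳ : ∀ {A : Set} y (xs : List A) (f : A → Carrier) → ∑ xs f * y ≈ ∑ xs (λ x → f x * y)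
  ∑-*ʳ y xs f = trans (*-comm _ y) (trans (∑-*ˡ y xs f) (∑-cong xs (λ x → *-comm y (f x))))

  prodR-∷ʳ : ∀ xs x → prodR (xs ∷ʳ x) ≈ prodR xs * x
  prodR-∷ʳ []       x = trans (*-identityʳ x) (sym (*-identityˡ x))
  prodR-∷ʳ (y ∷ xs) x = trans (*-congˡ (prodR-∷ʳ xs x)) (sym (*-assoc _ _ _))

  Σ< : ℕ → (ℕ → Carrier) → Carrier
  Σ< n f = sum {n} (λ i → f (toℕ i))

  Σ<-cong : ∀ n {f g : ℕ → Carrier} → (∀ i → i < n → f i ≈ g i) → Σ< n f ≈ Σ< n g
  Σ<-cong n f≈g = sum-cong-≋ {n} (λ i → f≈g (toℕ i) (toℕ<n i))

  Σ<-+ : ∀ n (f g : ℕ → Carrier) → Σ< n (λ i → f i + g i) ≈ Σ< n f + Σ< n g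
  Σ<-+ n f g = ∑-distrib-+ {n} (f ∘ toℕ) (g ∘ toℕ)

  Σ<-*ˡ : ∀ n y (f : ℕ → Carrier) → y * Σ< n f ≈ Σ< n (λ i → y * f i)
  Σ<-*ˡ n y f = *-distribˡ-sum {n} y (f ∘ toℕ)

  Σ<-*ʳ : ∀ n y (f : ℕ → Carrier) → Σ< n f * y ≈ Σ< n (λ i → f i * y)
  Σ<-*ʳ n y f = *-distribʳ-sum {n} y (f ∘ toℕ)

  Σ<-reverse : ∀ n (f : ℕ → Carrier) → Σ< n f ≈ Σ< n (λ i → f (n ∸ suc i))
  Σ<-reverse n f = trans (∑-permute {n} (f ∘ toℕ) reverse) (reflexive (sum-cong-≗ {n} (≡.cong f ∘ opposite-prop {n})))
    where open import Algebra.Properties.Monoid.Sum +-monoid using (sum-cong-≗)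

  Σ<-+-split : ∀ b m (f : ℕ → Carrier) → Σ< (b ℕ.+ m) f ≈ Σ< b f + Σ< m (λ j → f (b ℕ.+ j))
  Σ<-+-split zero    m f = sym (+-identityˡ _)
  Σ<-+-split (suc b) m f = trans (+-congˡ (Σ<-+-split b m (f ∘ suc))) (sym (+-assoc _ _ _))

  Σ<-skip : ∀ n b (g : ℕ → Carrier) → b ≤ n →
    Σ< (suc n) (λ i → if b ≡ᵇ i then 0# else g i) ≈ Σ< n (g ∘ shift≥ b)
  Σ<-skip n       zero    g _         = +-identityˡ _
  Σ<-skip (suc n) (suc b) g (s≤s b≤n) = +-congˡ (Σ<-skip n b (g ∘ suc) b≤n)

  ∑-Σ<-comm : ∀ {A : Set} (xs : List A) m (F : A → ℕ → Carrier) →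
    ∑ xs (λ x → Σ< m (F x)) ≈ Σ< m (λ i → ∑ xs (λ x → F x i))
  ∑-Σ<-comm []       m F = sym (sum-replicate-zero m)
  ∑-Σ<-comm (x ∷ xs) m F =
    trans (+-congˡ (∑-Σ<-comm xs m F)) (sym (Σ<-+ m (F x) (λ i → ∑ xs (λ y → F y i))))

  ∑-applyUpTo : ∀ (g : ℕ → ℕ) n (f : ℕ → Carrier) → ∑ (applyUpTo g n) f ≈ Σ< n (f ∘ g)
  ∑-applyUpTo g zero    f = refl
  ∑-applyUpTo g (suc n) f = +-congˡ (∑-applyUpTo (g ∘ suc) n f)

  ∑-upTo : ∀ n (f : ℕ → Carrier) → ∑ (upTo n) f ≈ Σ< n f
  ∑-upTo = ∑-applyUpTo (λ i → i)

  pow≡^ : ∀ x n → pow x n ≡ x ^ n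
  pow≡^ x zero    = ≡.refl
  pow≡^ x (suc n) = ≡.cong (x *_) (pow≡^ x n)

  pow-homo-* : ∀ x m n → pow x (m ℕ.+ n) ≈ pow x m * pow x n
  pow-homo-* x m n rewrite pow≡^ x (m ℕ.+ n) | pow≡^ x m | pow≡^ x n = ^-homo-* x m n

  pow-distrib-* : ∀ x y n → pow (x * y) n ≈ pow x n * pow y n
  pow-distrib-* x y n rewrite pow≡^ (x * y) n | pow≡^ x n | pow≡^ y n = ^-distrib-* x y n

  pow-assocʳ : ∀ x m n → pow (pow x m) n ≈ pow x (m ℕ.* n)
  pow-assocʳ x m n rewrite pow≡^ (pow x m) n | pow≡^ x m | pow≡^ x (m ℕ.* n) = ^-assocʳ x m n

  pow-congˡ : ∀ {x y} n → x ≈ y → pow x n ≈ pow y n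
  pow-congˡ zero    x≈y = refl
  pow-congˡ (suc n) x≈y = *-cong x≈y (pow-congˡ n x≈y)

  pow-1# : ∀ n → pow 1# n ≈ 1#
  pow-1# zero    = refl
  pow-1# (suc n) = trans (*-identityˡ _) (pow-1# n)

  qint≈Σ< : ∀ n t → qint n t ≈ Σ< n (pow t)
  qint≈Σ< n t = ∑-upTo n (pow t)

  qint-reversed : ∀ n t → Σ< n (λ i → pow t (n ∸ suc i)) ≈ qint n t
  qint-reversed n t = sym (trans (qint≈Σ< n t) (Σ<-reverse n (pow t)))

  qint-+ : ∀ b m t → qint (b ℕ.+ m) t ≈ qint b t + pow t b * qint m t
  qint-+ b m t = begin
    qint (b ℕ.+ m) t
      ≈⟨ qint≈Σ< (b ℕ.+ m) t ⟩
    Σ< (b ℕ.+ m) (pow t)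
      ≈⟨ Σ<-+-split b m (pow t) ⟩
    Σ< b (pow t) + Σ< m (λ j → pow t (b ℕ.+ j))
      ≈⟨ +-cong (sym (qint≈Σ< b t)) (Σ<-cong m (λ j _ → pow-homo-* t b j)) ⟩
    qint b t + Σ< m (λ j → pow t b * pow t j)
      ≈⟨ +-congˡ (sym (trans (*-congˡ (qint≈Σ< m t)) (Σ<-*ˡ m (pow t b) (pow t)))) ⟩
    qint b t + pow t b * qint m t
      ∎

  Σ<-threshold : ∀ {N b} x t → b ℕ.≤ N →
    Σ< N (λ i → (if i <ᵇ b then 1# else x) * pow t (N ∸ suc i))
      ≈ pow t (N ∸ b) * qint b t + x * qint (N ∸ b) t
  Σ<-threshold {N} {b} x t b≤N with N ∸ b | ℕ.m+[n∸m]≡n b≤N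
  ... | m | ≡.refl = begin
    Σ< (b ℕ.+ m) G                                      ≈⟨ Σ<-+-split b m G ⟩
    Σ< b G + Σ< m (G ∘ (b ℕ.+_))                        ≈⟨ +-cong (Σ<-cong b below) (Σ<-cong m (λ j _ → above j)) ⟩
    Σ< b (λ i → pow t m * pow t (b ∸ suc i)) + Σ< m (λ j → x * pow t (m ∸ suc j))
      ≈⟨ +-cong (sym (Σ<-*ˡ b (pow t m) (λ i → pow t (b ∸ suc i)))) (sym (Σ<-*ˡ m x (λ j → pow t (m ∸ suc j)))) ⟩
    pow t m * Σ< b (λ i → pow t (b ∸ suc i)) + x * Σ< m (λ j → pow t (m ∸ suc j))
      ≈⟨ +-cong (*-congˡ (qint-reversed b t)) (*-congˡ (qint-reversed m t)) ⟩
    pow t m * qint b t + x * qint m t                   ∎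
    where
    G : ℕ → Carrier
    G i = (if i <ᵇ b then 1# else x) * pow t (b ℕ.+ m ∸ suc i)
    below : ∀ i → i < b → G i ≈ pow t m * pow t (b ∸ suc i)
    below i i<b rewrite T-≡ .Equivalence.to (ℕ.<⇒<ᵇ i<b) | ℕ.+-∸-comm m i<b = begin
      1# * pow t (b ∸ suc i ℕ.+ m)       ≈⟨ *-identityˡ _ ⟩
      pow t (b ∸ suc i ℕ.+ m)            ≈⟨ pow-homo-* t (b ∸ suc i) m ⟩
      pow t (b ∸ suc i) * pow t m        ≈⟨ *-comm _ _ ⟩
      pow t m * pow t (b ∸ suc i)        ∎
    b+j≮b : ∀ b j → (b ℕ.+ j <ᵇ b) ≡ false
    b+j≮b zero    j = ≡.refl
    b+j≮b (suc b) j = b+j≮b b j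
    above : ∀ j → G (b ℕ.+ j) ≈ x * pow t (m ∸ suc j)
    above j rewrite b+j≮b b j | ≡.sym (ℕ.+-suc b j) | ℕ.[m+n]∸[m+o]≡n∸o b m (suc j) = refl

  qint-homogenised : ∀ k t z z⁻¹ → z * z⁻¹ ≈ 1# →
    Σ< (suc k) (λ b → pow t (k ∸ b) * pow z b) ≈ qint (suc k) (t * z⁻¹) * pow z k
  qint-homogenised k t z z⁻¹ zz⁻¹≈1 = begin
    Σ< (suc k) (λ b → pow t (k ∸ b) * pow z b)
      ≈⟨ Σ<-reverse (suc k) (λ b → pow t (k ∸ b) * pow z b) ⟩
    Σ< (suc k) (λ j → pow t (k ∸ (k ∸ j)) * pow z (k ∸ j))
      ≈⟨ Σ<-cong (suc k) (λ j j<sk → sym (dehomogenise j (ℕ.≤-pred j<sk))) ⟩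
    Σ< (suc k) (λ j → pow (t * z⁻¹) j * pow z k)
      ≈⟨ sym (Σ<-*ʳ (suc k) (pow z k) (pow (t * z⁻¹))) ⟩
    Σ< (suc k) (pow (t * z⁻¹)) * pow z k
      ≈⟨ *-congʳ (sym (qint≈Σ< (suc k) (t * z⁻¹))) ⟩
    qint (suc k) (t * z⁻¹) * pow z k
      ∎
    where
    dehomogenise : ∀ j → j ℕ.≤ k → pow (t * z⁻¹) j * pow z k ≈ pow t (k ∸ (k ∸ j)) * pow z (k ∸ j)
    dehomogenise j j≤k rewrite ℕ.m∸[m∸n]≡n j≤k = begin
      pow (t * z⁻¹) j * pow z k
        ≈⟨ *-cong (pow-distrib-* t z⁻¹ j) (reflexive (≡.cong (pow z) (≡.sym (ℕ.m+[n∸m]≡n j≤k)))) ⟩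
      (pow t j * pow z⁻¹ j) * pow z (j ℕ.+ (k ∸ j))          ≈⟨ *-congˡ (pow-homo-* z j (k ∸ j)) ⟩
      (pow t j * pow z⁻¹ j) * (pow z j * pow z (k ∸ j))      ≈⟨ *-assoc _ _ _ ⟩
      pow t j * (pow z⁻¹ j * (pow z j * pow z (k ∸ j)))      ≈⟨ *-congˡ (sym (*-assoc _ _ _)) ⟩
      pow t j * ((pow z⁻¹ j * pow z j) * pow z (k ∸ j))      ≈⟨ *-congˡ (*-congʳ cancel) ⟩
      pow t j * (1# * pow z (k ∸ j))                         ≈⟨ *-congˡ (*-identityˡ _) ⟩
      pow t j * pow z (k ∸ j)                                ∎
      where
      cancel : pow z⁻¹ j * pow z j ≈ 1#
      cancel = trans (sym (pow-distrib-* z⁻¹ z j)) (trans (pow-congˡ j (trans (*-comm z⁻¹ z) zz⁻¹≈1)) (pow-1# j))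

module PermutationSums {c ℓ : Level} (R : CommutativeRing c ℓ) where

  open import Function using (_∘_)
  open import Data.Bool using (true; false; _∧_; not; if_then_else_)
  open import Data.Bool.ListAction using (any)
  open import Data.Bool.Properties using (T-≡)
  open import Data.Nat as ℕ using (zero; _≡ᵇ_; s≤s; z≤n)
  open import Data.List using (List; []; _∷_; _∷ʳ_; map; length; upTo)
  open import Data.List.Relation.Unary.All using (All; []; _∷_)
  open import Data.Product using (_×_; _,_)
  open import Function.Bundles using (Equivalence)
  open import Relation.Binary.PropositionalEquality as ≡ using (_≡_)
  open CommutativeRing R hiding (zero)
  open RingOps R
  open FiniteSums R
  open import Relation.Binary.Reasoning.Setoid setoid

  ∑-words-suc : ∀ m k (g : List ℕ → Carrier) →
    ∑ (words m (suc k)) g ≈ Σ< m (λ i → ∑ (words m k) (λ w → g (suc i ∷ w)))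
  ∑-words-suc m k g = begin
    ∑ (words m (suc k)) g
      ≈⟨ ∑-concatMap (λ a → map (a ∷_) (words m k)) (map suc (upTo m)) g ⟩
    ∑ (map suc (upTo m)) (λ a → ∑ (map (a ∷_) (words m k)) g)
      ≡⟨ ∑-map suc (upTo m) _ ⟩
    ∑ (upTo m) (λ i → ∑ (map (suc i ∷_) (words m k)) g)
      ≈⟨ ∑-upTo m _ ⟩
    Σ< m (λ i → ∑ (map (suc i ∷_) (words m k)) g)
      ≈⟨ Σ<-cong m (λ i _ → reflexive (∑-map (suc i ∷_) (words m k) g)) ⟩
    Σ< m (λ i → ∑ (words m k) (λ w → g (suc i ∷ w)))
      ∎

  ∑-words-∷ʳ : ∀ m k (g : List ℕ → Carrier) →
    ∑ (words m (suc k)) g ≈ ∑ (words m k) (λ w → Σ< m (λ i → g (w ∷ʳ suc i)))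
  ∑-words-∷ʳ m zero    g =
    trans (∑-words-suc m zero g) (trans (Σ<-cong m (λ i _ → +-identityʳ (g (suc i ∷ [])))) (sym (+-identityʳ _)))
  ∑-words-∷ʳ m (suc k) g = begin
    ∑ (words m (suc (suc k))) g
      ≈⟨ ∑-words-suc m (suc k) g ⟩
    Σ< m (λ i → ∑ (words m (suc k)) (λ w → g (suc i ∷ w)))
      ≈⟨ Σ<-cong m (λ i _ → ∑-words-∷ʳ m k (λ w → g (suc i ∷ w))) ⟩
    Σ< m (λ i → ∑ (words m k) (λ w → Σ< m (λ j → g (suc i ∷ w ∷ʳ suc j))))
      ≈⟨ sym (∑-words-suc m k (λ v → Σ< m (λ j → g (v ∷ʳ suc j)))) ⟩
    ∑ (words m (suc k)) (λ w → Σ< m (λ j → g (w ∷ʳ suc j)))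
      ∎

  ∑-words-cong : ∀ m k {f g : List ℕ → Carrier} →
    (∀ w → length w ≡ k → All (λ y → 1 ℕ.≤ y × y ℕ.≤ m) w → f w ≈ g w) →
    ∑ (words m k) f ≈ ∑ (words m k) g
  ∑-words-cong m zero    f≈g = +-congʳ (f≈g [] ≡.refl [])
  ∑-words-cong m (suc k) {f} {g} f≈g = begin
    ∑ (words m (suc k)) f
      ≈⟨ ∑-words-suc m k f ⟩
    Σ< m (λ i → ∑ (words m k) (λ w → f (suc i ∷ w)))
      ≈⟨ Σ<-cong m (λ i i<m → ∑-words-cong m k (λ w len bounded →
           f≈g (suc i ∷ w) (≡.cong suc len) ((s≤s z≤n , i<m) ∷ bounded))) ⟩
    Σ< m (λ i → ∑ (words m k) (λ w → g (suc i ∷ w)))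
      ≈⟨ sym (∑-words-suc m k g) ⟩
    ∑ (words m (suc k)) g
      ∎

  ∑-words-avoiding : ∀ n b k (g : List ℕ → Carrier) → b ℕ.≤ n →
    ∑ (words (suc n) k) (λ w → if not (any (suc b ≡ᵇ_) w) then g w else 0#) ≈
    ∑ (words n k) (λ σ → g (map (shift≥ (suc b)) σ))
  ∑-words-avoiding n b zero    g _   = refl
  ∑-words-avoiding n b (suc k) g b≤n = begin
    ∑ (words (suc n) (suc k)) (avoiding g)
      ≈⟨ ∑-words-suc (suc n) k (avoiding g) ⟩
    Σ< (suc n) (λ i → ∑ (words (suc n) k) (λ w → avoiding g (suc i ∷ w)))
      ≈⟨ Σ<-cong (suc n) (λ i _ → first-letter i) ⟩
    Σ< (suc n) (λ i → if b ≡ᵇ i then 0# else ∑ (words (suc n) k) (avoiding (g ∘ (suc i ∷_))))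
      ≈⟨ Σ<-skip n b (λ i → ∑ (words (suc n) k) (avoiding (g ∘ (suc i ∷_)))) b≤n ⟩
    Σ< n (λ i → ∑ (words (suc n) k) (avoiding (g ∘ (suc (shift≥ b i) ∷_))))
      ≈⟨ Σ<-cong n (λ i _ → ∑-words-avoiding n b k (g ∘ (suc (shift≥ b i) ∷_)) b≤n) ⟩
    Σ< n (λ i → ∑ (words n k) (λ σ → g (map (shift≥ (suc b)) (suc i ∷ σ))))
      ≈⟨ sym (∑-words-suc n k (g ∘ map (shift≥ (suc b)))) ⟩
    ∑ (words n (suc k)) (g ∘ map (shift≥ (suc b)))
      ∎
    where
    avoiding : (List ℕ → Carrier) → List ℕ → Carrier
    avoiding h w = if not (any (suc b ≡ᵇ_) w) then h w else 0#
    first-letter : ∀ i → ∑ (words (suc n) k) (λ w → avoiding g (suc i ∷ w)) ≈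
                         (if b ≡ᵇ i then 0# else ∑ (words (suc n) k) (avoiding (g ∘ (suc i ∷_))))
    first-letter i with b ≡ᵇ i
    ... | true  = ∑-zero (words (suc n) k)
    ... | false = refl

  when-distinct : (List ℕ → Carrier) → List ℕ → Carrier
  when-distinct f w = if distinct w then f w else 0#

  ∑-Sn : ∀ n (f : List ℕ → Carrier) → ∑ (Sn n) f ≈ ∑ (words n n) (when-distinct f)
  ∑-Sn n = ∑-filterᵇ distinct (words n n)

  ∑-Sn-cong : ∀ n {f g : List ℕ → Carrier} → (∀ σ → IsPermutation n σ → f σ ≈ g σ) → ∑ (Sn n) f ≈ ∑ (Sn n) g
  ∑-Sn-cong n {f} {g} f≈g = begin
    ∑ (Sn n) f                        ≈⟨ ∑-Sn n f ⟩
    ∑ (words n n) (when-distinct f)   ≈⟨ ∑-words-cong n n pointwise ⟩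
    ∑ (words n n) (when-distinct g)   ≈⟨ sym (∑-Sn n g) ⟩
    ∑ (Sn n) g                        ∎
    where
    pointwise : ∀ w → length w ≡ n → All (λ y → 1 ℕ.≤ y × y ℕ.≤ n) w → when-distinct f w ≈ when-distinct g w
    pointwise w len bounded with distinct w in d
    ... | true  = f≈g w (record { letters-distinct = T-≡ .Equivalence.from d ; length≡ = len ; letters-bounded = bounded })
    ... | false = refl

  ∑-Sn-suc : ∀ n (f : List ℕ → Carrier) →
    ∑ (Sn (suc n)) f ≈ Σ< (suc n) (λ b → ∑ (Sn n) (λ σ → f (extend σ (suc b))))
  ∑-Sn-suc n f = begin
    ∑ (Sn (suc n)) f
      ≈⟨ ∑-Sn (suc n) f ⟩
    ∑ (words (suc n) (suc n)) (when-distinct f)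
      ≈⟨ ∑-words-∷ʳ (suc n) n (when-distinct f) ⟩
    ∑ (words (suc n) n) (λ w → Σ< (suc n) (λ i → when-distinct f (w ∷ʳ suc i)))
      ≈⟨ ∑-Σ<-comm (words (suc n) n) (suc n) (λ w i → when-distinct f (w ∷ʳ suc i)) ⟩
    Σ< (suc n) (λ i → ∑ (words (suc n) n) (λ w → when-distinct f (w ∷ʳ suc i)))
      ≈⟨ Σ<-cong (suc n) (λ i i<sn → last-letter i (ℕ.≤-pred i<sn)) ⟩
    Σ< (suc n) (λ b → ∑ (Sn n) (λ σ → f (extend σ (suc b))))
      ∎
    where
    if-∧ : ∀ p q (x : Carrier) → (if p ∧ q then x else 0#) ≡ (if p then (if q then x else 0#) else 0#)
    if-∧ true  q x = ≡.refl
    if-∧ false q x = ≡.refl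
    last-letter : ∀ i → i ℕ.≤ n →
      ∑ (words (suc n) n) (λ w → when-distinct f (w ∷ʳ suc i)) ≈ ∑ (Sn n) (λ σ → f (extend σ (suc i)))
    last-letter i i≤n = begin
      ∑ (words (suc n) n) (λ w → when-distinct f (w ∷ʳ suc i))
        ≈⟨ ∑-cong (words (suc n) n) (λ w → reflexive (≡.trans
             (≡.cong (λ p → if p then f (w ∷ʳ suc i) else 0#) (distinct-∷ʳ w (suc i)))
             (if-∧ (not (any (suc i ≡ᵇ_) w)) (distinct w) _))) ⟩
      ∑ (words (suc n) n) (λ w → if not (any (suc i ≡ᵇ_) w) then when-distinct (f ∘ (_∷ʳ suc i)) w else 0#)
        ≈⟨ ∑-words-avoiding n i n (when-distinct (f ∘ (_∷ʳ suc i))) i≤n ⟩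
      ∑ (words n n) (λ σ → when-distinct (f ∘ (_∷ʳ suc i)) (map (shift≥ (suc i)) σ))
        ≈⟨ ∑-cong (words n n) (λ σ → reflexive
             (≡.cong (λ p → if p then f (extend σ (suc i)) else 0#) (distinct-map-shift≥ (suc i) σ))) ⟩
      ∑ (words n n) (when-distinct (λ σ → f (extend σ (suc i))))
        ≈⟨ sym (∑-Sn n (λ σ → f (extend σ (suc i)))) ⟩
      ∑ (Sn n) (λ σ → f (extend σ (suc i)))
        ∎

module SignedMajorIndex {c ℓ : Level} (R : CommutativeRing c ℓ) (ε q : CommutativeRing.Carrier R) where

  open import Function using (_∘_)
  open import Data.Bool using (true; false; if_then_else_)
  open import Data.Nat as ℕ using (zero; _<ᵇ_)
  import Data.Nat.Properties as ℕ
  open import Data.Nat.Tactic.RingSolver using (solve-∀)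
  open import Data.List using (List; []; _∷_; _∷ʳ_; map; upTo)
  open import Data.List.Properties using (map-++; upTo-∷ʳ)
  open import Relation.Nullary using (contradiction)
  open import Relation.Binary.PropositionalEquality as ≡ using (_≡_)
  open CommutativeRing R hiding (zero)
  open import Algebra.Properties.CommutativeSemigroup *-commutativeSemigroup using (interchange; x∙yz≈y∙xz)
  open RingOps R
  open FiniteSums R
  open PermutationSums R
  open import Relation.Binary.Reasoning.Setoid setoid

  weight : List ℕ → Carrier
  weight π = pow ε (inv π) * pow q (maj π)

  weight-extend : ∀ {n σ b} → IsPermutation (suc n) σ → b ≤ suc n →
    weight (extend σ (suc b)) ≈ pow ε (suc n ∸ b) * ((if lastElem σ <ᵇ suc b then 1# else pow q (suc n)) * weight σ)
  weight-extend {σ = []} perm _ = contradiction (IsPermutation.length≡ perm) λ ()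
  weight-extend {n} {σ@(x ∷ xs)} {b} perm b≤sn = begin
    pow ε (inv (extend σ (suc b))) * pow q (maj (extend σ (suc b)))
      ≡⟨ ≡.cong₂ (λ i j → pow ε i * pow q j) inv-eq maj-eq ⟩
    pow ε (inv σ ℕ.+ m) * pow q (maj σ ℕ.+ d)
      ≈⟨ *-cong (pow-homo-* ε (inv σ) m) (pow-homo-* q (maj σ) d) ⟩
    (pow ε (inv σ) * pow ε m) * (pow q (maj σ) * pow q d)
      ≈⟨ interchange _ _ _ _ ⟩
    weight σ * (pow ε m * pow q d)
      ≈⟨ *-comm _ _ ⟩
    (pow ε m * pow q d) * weight σ
      ≈⟨ *-assoc _ _ _ ⟩
    pow ε m * (pow q d * weight σ)
      ≡⟨ ≡.cong (λ y → pow ε m * (y * weight σ)) (pow-if (lastElem σ <ᵇ suc b)) ⟩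
    pow ε m * ((if lastElem σ <ᵇ suc b then 1# else pow q (suc n)) * weight σ)
      ∎
    where
    m = suc n ∸ b
    d = if lastElem σ <ᵇ suc b then 0 else suc n
    inv-eq : inv (extend σ (suc b)) ≡ inv σ ℕ.+ m
    inv-eq = ≡.trans (inv-extend σ (suc b)) (≡.cong (inv σ ℕ.+_) (count-≥-permutation perm b≤sn))
    maj-eq : maj (extend σ (suc b)) ≡ maj σ ℕ.+ d
    maj-eq = ≡.trans (maj-extend x xs (suc b))
      (≡.cong (λ l → maj σ ℕ.+ (if lastElem σ <ᵇ suc b then 0 else l)) (IsPermutation.length≡ perm))
    pow-if : ∀ p → pow q (if p then 0 else suc n) ≡ (if p then 1# else pow q (suc n))
    pow-if true  = ≡.refl
    pow-if false = ≡.refl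

  -- Σ ε^inv q^maj over the permutations of length n+1 whose last letter is b+1 (by ∑-Sn-suc).
  endingAt : ℕ → ℕ → Carrier
  endingAt n b = ∑ (Sn n) (λ σ → weight (extend σ (suc b)))

  endingAt-suc : ∀ n b → b ≤ suc n →
    endingAt (suc n) b ≈
      pow ε (suc n ∸ b) * Σ< (suc n) (λ b′ → (if b′ <ᵇ b then 1# else pow q (suc n)) * endingAt n b′)
  endingAt-suc n b b≤sn = begin
    endingAt (suc n) b
      ≈⟨ ∑-Sn-cong (suc n) (λ σ perm → weight-extend perm b≤sn) ⟩
    ∑ (Sn (suc n)) (λ σ → pow ε m * (descent (lastElem σ) * weight σ))
      ≈⟨ sym (∑-*ˡ (pow ε m) (Sn (suc n)) _) ⟩
    pow ε m * ∑ (Sn (suc n)) (λ σ → descent (lastElem σ) * weight σ)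
      ≈⟨ *-congˡ (∑-Sn-suc n _) ⟩
    pow ε m * Σ< (suc n) (λ b′ → ∑ (Sn n) (λ τ → descent (lastElem (extend τ (suc b′))) * weight (extend τ (suc b′))))
      ≈⟨ *-congˡ (Σ<-cong (suc n) (λ b′ _ → last-letter b′)) ⟩
    pow ε m * Σ< (suc n) (λ b′ → descent (suc b′) * endingAt n b′)
      ∎
    where
    m = suc n ∸ b
    descent : ℕ → Carrier
    descent l = if l <ᵇ suc b then 1# else pow q (suc n)
    last-letter : ∀ b′ → ∑ (Sn n) (λ τ → descent (lastElem (extend τ (suc b′))) * weight (extend τ (suc b′)))
                           ≈ descent (suc b′) * endingAt n b′
    last-letter b′ = trans
      (∑-cong (Sn n) (λ τ → reflexive
        (≡.cong (λ l → descent l * weight (extend τ (suc b′))) (lastElem-extend τ (suc b′)))))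
      (sym (∑-*ˡ (descent (suc b′)) (Sn n) _))

  ∑-by-last-letter : ∀ n z →
    ∑ (Sn (suc n)) (λ π → weight π * pow z (lastStat π)) ≈ Σ< (suc n) (λ b → endingAt n b * pow z b)
  ∑-by-last-letter n z = begin
    ∑ (Sn (suc n)) (λ π → weight π * pow z (lastStat π))
      ≈⟨ ∑-Sn-suc n (λ π → weight π * pow z (lastStat π)) ⟩
    Σ< (suc n) (λ b → ∑ (Sn n) (λ σ → weight (extend σ (suc b)) * pow z (lastStat (extend σ (suc b)))))
      ≈⟨ Σ<-cong (suc n) (λ b _ → fibre b) ⟩
    Σ< (suc n) (λ b → endingAt n b * pow z b)
      ∎
    where
    fibre : ∀ b → ∑ (Sn n) (λ σ → weight (extend σ (suc b)) * pow z (lastStat (extend σ (suc b))))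
                  ≈ endingAt n b * pow z b
    fibre b = trans
      (∑-cong (Sn n) (λ σ → reflexive (≡.cong (λ e → weight (extend σ (suc b)) * pow z e) (lastStat-extend σ b))))
      (sym (∑-*ʳ (pow z b) (Sn n) (λ σ → weight (extend σ (suc b)))))

  prodPart-suc : ∀ n → prodPart (suc (suc n)) ε q ≈ prodPart (suc n) ε q * qint (suc n) (pow ε n * q)
  prodPart-suc n = begin
    prodR (map factor (upTo (suc n)))      ≡⟨ ≡.cong (prodR ∘ map factor) (≡.sym (upTo-∷ʳ n)) ⟩
    prodR (map factor (upTo n ∷ʳ n))       ≡⟨ ≡.cong prodR (map-++ factor (upTo n) (n ∷ [])) ⟩
    prodR (map factor (upTo n) ∷ʳ factor n) ≈⟨ prodR-∷ʳ (map factor (upTo n)) (factor n) ⟩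
    prodR (map factor (upTo n)) * factor n  ∎
    where
    factor : ℕ → Carrier
    factor j = qint (suc j) (pow ε j * q)

  absorb-ε : ∀ n m → pow ε m * pow (pow ε n * q) m ≈ pow (pow ε (suc n) * q) m
  absorb-ε n m = begin
    pow ε m * pow (pow ε n * q) m                 ≈⟨ *-congˡ (pow-distrib-* (pow ε n) q m) ⟩
    pow ε m * (pow (pow ε n) m * pow q m)         ≈⟨ sym (*-assoc _ _ _) ⟩
    (pow ε m * pow (pow ε n) m) * pow q m         ≈⟨ *-congʳ (sym (pow-distrib-* ε (pow ε n) m)) ⟩
    pow (pow ε (suc n)) m * pow q m               ≈⟨ sym (pow-distrib-* (pow ε (suc n)) q m) ⟩
    pow (pow ε (suc n) * q) m                     ∎

  module _ (ε²≈1 : ε * ε ≈ 1#) where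

    pow-ε-even : ∀ j → pow ε (j ℕ.+ j) ≈ 1#
    pow-ε-even j = begin
      pow ε (j ℕ.+ j)          ≈⟨ pow-homo-* ε j j ⟩
      pow ε j * pow ε j        ≈⟨ sym (pow-distrib-* ε ε j) ⟩
      pow (ε * ε) j            ≈⟨ pow-congˡ j ε²≈1 ⟩
      pow 1# j                 ≈⟨ pow-1# j ⟩
      1#                       ∎

    pow-ε-pronic : ∀ n → pow ε (n ℕ.* suc n) ≈ 1#
    pow-ε-pronic zero    = refl
    pow-ε-pronic (suc n) = begin
      pow ε (suc n ℕ.* suc (suc n))                       ≡⟨ ≡.cong (pow ε) (pronic-suc n) ⟩
      pow ε (n ℕ.* suc n ℕ.+ (suc n ℕ.+ suc n))           ≈⟨ pow-homo-* ε (n ℕ.* suc n) (suc n ℕ.+ suc n) ⟩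
      pow ε (n ℕ.* suc n) * pow ε (suc n ℕ.+ suc n)       ≈⟨ *-cong (pow-ε-pronic n) (pow-ε-even (suc n)) ⟩
      1# * 1#                                             ≈⟨ *-identityˡ 1# ⟩
      1#                                                  ∎
      where
      pronic-suc : ∀ n → suc n ℕ.* suc (suc n) ≡ n ℕ.* suc n ℕ.+ (suc n ℕ.+ suc n)
      pronic-suc = solve-∀

    pow-signed-q : ∀ n → pow (pow ε n * q) (suc n) ≈ pow q (suc n)
    pow-signed-q n = begin
      pow (pow ε n * q) (suc n)                ≈⟨ pow-distrib-* (pow ε n) q (suc n) ⟩
      pow (pow ε n) (suc n) * pow q (suc n)    ≈⟨ *-congʳ (trans (pow-assocʳ ε n (suc n)) (pow-ε-pronic n)) ⟩
      1# * pow q (suc n)                       ≈⟨ *-identityˡ _ ⟩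
      pow q (suc n)                            ∎

    q-power-split : ∀ n b m → b ℕ.+ m ≡ suc n →
      pow ε m * pow q (suc n) ≈ pow (pow ε n * q) b * pow (pow ε (suc n) * q) m
    q-power-split n b m b+m≡sn = begin
      pow ε m * pow q (suc n)                         ≈⟨ *-congˡ (sym (pow-signed-q n)) ⟩
      pow ε m * pow t (suc n)                         ≡⟨ ≡.cong (λ e → pow ε m * pow t e) (≡.sym b+m≡sn) ⟩
      pow ε m * pow t (b ℕ.+ m)                       ≈⟨ *-congˡ (pow-homo-* t b m) ⟩
      pow ε m * (pow t b * pow t m)                   ≈⟨ x∙yz≈y∙xz _ _ _ ⟩
      pow t b * (pow ε m * pow t m)                   ≈⟨ *-congˡ (absorb-ε n m) ⟩
      pow t b * pow (pow ε (suc n) * q) m             ∎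
      where
      t = pow ε n * q

    closed-form-step : ∀ n b → b ≤ suc n →
      pow ε (suc n ∸ b) * Σ< (suc n) (λ b′ → (if b′ <ᵇ b then 1# else pow q (suc n))
                                          * (prodPart (suc n) ε q * pow (pow ε n * q) (n ∸ b′)))
        ≈ prodPart (suc (suc n)) ε q * pow (pow ε (suc n) * q) (suc n ∸ b)
    closed-form-step n b b≤sn = begin
      pow ε m * Σ< (suc n) (λ b′ → descent b′ * (P * pow t (n ∸ b′)))
        ≈⟨ *-congˡ (trans (Σ<-cong (suc n) (λ b′ _ → x∙yz≈y∙xz (descent b′) P (pow t (n ∸ b′))))
                          (sym (Σ<-*ˡ (suc n) P (λ b′ → descent b′ * pow t (n ∸ b′))))) ⟩
      pow ε m * (P * Σ< (suc n) (λ b′ → descent b′ * pow t (n ∸ b′)))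
        ≈⟨ *-congˡ (*-congˡ (Σ<-threshold (pow q (suc n)) t b≤sn)) ⟩
      pow ε m * (P * (pow t m * qint b t + pow q (suc n) * qint m t))
        ≈⟨ x∙yz≈y∙xz _ _ _ ⟩
      P * (pow ε m * (pow t m * qint b t + pow q (suc n) * qint m t))
        ≈⟨ *-congˡ (trans (distribˡ _ _ _) (+-cong (sym (*-assoc _ _ _)) (sym (*-assoc _ _ _)))) ⟩
      P * ((pow ε m * pow t m) * qint b t + (pow ε m * pow q (suc n)) * qint m t)
        ≈⟨ *-congˡ (+-cong (*-congʳ (absorb-ε n m)) (*-congʳ (q-power-split n b m b+m≡sn))) ⟩
      P * (pow T m * qint b t + (pow t b * pow T m) * qint m t)
        ≈⟨ *-congˡ (+-congˡ (trans (*-congʳ (*-comm _ _)) (*-assoc _ _ _))) ⟩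
      P * (pow T m * qint b t + pow T m * (pow t b * qint m t))
        ≈⟨ *-congˡ (sym (distribˡ _ _ _)) ⟩
      P * (pow T m * (qint b t + pow t b * qint m t))
        ≈⟨ *-congˡ (*-congˡ (sym (trans (reflexive (≡.cong (λ N → qint N t) (≡.sym b+m≡sn))) (qint-+ b m t)))) ⟩
      P * (pow T m * qint (suc n) t)
        ≈⟨ trans (*-congˡ (*-comm _ _)) (sym (*-assoc _ _ _)) ⟩
      (P * qint (suc n) t) * pow T m
        ≈⟨ *-congʳ (sym (prodPart-suc n)) ⟩
      prodPart (suc (suc n)) ε q * pow T m
        ∎
      where
      m = suc n ∸ b
      P = prodPart (suc n) ε q
      t = pow ε n * q
      T = pow ε (suc n) * q
      descent : ℕ → Carrier
      descent b′ = if b′ <ᵇ b then 1# else pow q (suc n)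
      b+m≡sn : b ℕ.+ m ≡ suc n
      b+m≡sn = ℕ.m+[n∸m]≡n b≤sn

    endingAt-closed : ∀ n b → b ≤ n → endingAt n b ≈ prodPart (suc n) ε q * pow (pow ε n * q) (n ∸ b)
    endingAt-closed zero    zero _    = +-identityʳ _
    endingAt-closed (suc n) b    b≤sn = begin
      endingAt (suc n) b
        ≈⟨ endingAt-suc n b b≤sn ⟩
      pow ε (suc n ∸ b) * Σ< (suc n) (λ b′ → descent b′ * endingAt n b′)
        ≈⟨ *-congˡ (Σ<-cong (suc n) (λ b′ b′<sn → *-congˡ {descent b′} (endingAt-closed n b′ (ℕ.≤-pred b′<sn)))) ⟩
      pow ε (suc n ∸ b) * Σ< (suc n) (λ b′ → descent b′ * (prodPart (suc n) ε q * pow (pow ε n * q) (n ∸ b′)))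
        ≈⟨ closed-form-step n b b≤sn ⟩
      prodPart (suc (suc n)) ε q * pow (pow ε (suc n) * q) (suc n ∸ b)
        ∎
      where
      descent : ℕ → Carrier
      descent b′ = if b′ <ᵇ b then 1# else pow q (suc n)

theorem3p2 : {c ℓ : Level} (R : CommutativeRing c ℓ) →
    let open CommutativeRing R
        open RingOps R
    in (n : ℕ) → 1 ≤ n →
       (ε : Carrier) → (ε ≈ 1# ⊎ ε ≈ - 1#) →
       (q z z⁻¹ : Carrier) → z * z⁻¹ ≈ 1# →
       lhs n ε q z ≈
         prodPart n ε q * qint n (pow ε (n ∸ 1) * q * z⁻¹) * pow z (n ∸ 1)
theorem3p2 R (suc k) _ ε ε≈±1 q z z⁻¹ zz⁻¹≈1 = begin
  lhs (suc k) ε q z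
    ≈⟨ ∑-by-last-letter k z ⟩
  Σ< (suc k) (λ b → endingAt k b * pow z b)
    ≈⟨ Σ<-cong (suc k) (λ b b<sk →
         trans (*-congʳ (endingAt-closed ε²≈1 k b (≤-pred b<sk))) (*-assoc P (pow t (k ∸ b)) (pow z b))) ⟩
  Σ< (suc k) (λ b → P * (pow t (k ∸ b) * pow z b))
    ≈⟨ sym (Σ<-*ˡ (suc k) P (λ b → pow t (k ∸ b) * pow z b)) ⟩
  P * Σ< (suc k) (λ b → pow t (k ∸ b) * pow z b)
    ≈⟨ *-congˡ (qint-homogenised k t z z⁻¹ zz⁻¹≈1) ⟩
  P * (qint (suc k) (t * z⁻¹) * pow z k)
    ≈⟨ sym (*-assoc _ _ _) ⟩
  P * qint (suc k) (t * z⁻¹) * pow z k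
    ∎
  where
  open CommutativeRing R
  open RingOps R
  open FiniteSums R
  open PermutationSums R
  open SignedMajorIndex R ε q
  open import Relation.Binary.Reasoning.Setoid setoid
  open import Data.Nat.Properties using (≤-pred)
  open import Algebra.Properties.Ring ring using (-1*x≈-x; -‿involutive)
  P = prodPart (suc k) ε q
  t = pow ε k * q
  ±1-squared : ∀ {x} → x ≈ 1# ⊎ x ≈ - 1# → x * x ≈ 1#
  ±1-squared (inj₁ x≈1)  = trans (*-cong x≈1 x≈1) (*-identityˡ 1#)
  ±1-squared (inj₂ x≈-1) = trans (*-cong x≈-1 x≈-1) (trans (-1*x≈-x (- 1#)) (-‿involutive 1#))
  ε²≈1 : ε * ε ≈ 1#
  ε²≈1 = ±1-squared ε≈±1
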